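{- Let $(G,w)$ be a weighted game graph and $M$ an upper bound on the finite minimal energy (for every node $v$, $e^*_{G,w}(v)<\infty$ implies $e^*_{G,w}(v)\le M$). Let $U_M=\{0,1,\dots,M,\infty\}$, $R_{G,w}=\{w(u,v):(u,v)\in E\}$ and \[ C_{G,w}=\Big\{ -\sum_{i=1}^k x_i : x_i\in R_{G,w}\text{ for all } i,\ 0\le k\le n\Big\}\cup\{\infty\}. \] Then $e^*_{G,w}(v)\in C_{G,w}\cap U_M$ for every node $v\in V$.
   Context: A weighted game graph $(G,w)$ consists of a finite directed graph $G=(V,E)$ in which every node has out-degree at least $1$, a partition $V=V_A\cup V_B$ into nodes of Alice and of Bob, and integer edge weights $w:E\to\mathbb{Z}$; $n=|V|$. A (positional) strategy $\sigma$ of Alice picks for each $u\in V_A$ an out-neighbor $\sigma(u)$; a strategy $\tau$ of Bob picks for each $u\in V_B$ an out-neighbor $\tau(u)$. $G(\sigma,\tau)$ is the subgraph with edges $\{(u,\sigma(u)):u\in V_A\}\cup\{(u,\tau(u)):u\in V_B\}$; from any node $s$ there is a unique cycle $C$ reachable in it. $w(P)$ is the total weight of a path/cycle $P$. Set $e^*_{G(\sigma,\tau),w}(s)=\infty$ if $w(C)<0$, else $\max\{0,-\min_P w(P)\}$ over simple paths $P$ in $G(\sigma,\tau)$ starting at $s$. The minimal energy is $e^*_{G,w}(s)=\min_\sigma\max_\tau e^*_{G(\sigma,\tau),w}(s)$. The empty sum ($k=0$) equals $0$. -}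

module Defs where

open import Data.Nat as ℕ using (ℕ; zero; suc)
open import Data.Integer as ℤ using (ℤ; +_; 0ℤ; -_; ∣_∣)
open import Data.Integer.Properties using (_<?_)
open import Data.Fin using (Fin; _≟_)
open import Data.Bool using (Bool; true; false; _∧_; _∨_; not; if_then_else_)
open import Data.List using (List; []; _∷_; map; concat; concatMap; foldr; filterᵇ; upTo; allFin; length)
open import Data.List.Relation.Unary.All using (All)
open import Data.Bool.ListAction using (any; all)
open import Data.Vec using (Vec; lookup) renaming ([] to []ᵥ; _∷_ to _∷ᵥ_)
open import Data.Product using (Σ; ∃; _×_; _,_)
open import Data.Unit using (⊤)
open import Relation.Nullary.Decidable using (⌊_⌋)
open import Relation.Binary.PropositionalEquality using (_≡_)

record GameGraph (n : ℕ) : Set where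
  field
    alice  : Fin n → Bool          -- true iff the node belongs to V_A (else V_B)
    edge   : Fin n → Fin n → Bool
    w      : Fin n → Fin n → ℤ     -- edge weight w(u,v); only meaningful on edges
    outdeg : ∀ u → ∃ λ v → edge u v ≡ true
open GameGraph public

data ℕ∞ : Set where
  fin : ℕ → ℕ∞
  ∞   : ℕ∞

_⊓∞_ : ℕ∞ → ℕ∞ → ℕ∞
fin a ⊓∞ fin b = fin (a ℕ.⊓ b)
fin a ⊓∞ ∞     = fin a
∞     ⊓∞ y     = y

_⊔∞_ : ℕ∞ → ℕ∞ → ℕ∞
fin a ⊔∞ fin b = fin (a ℕ.⊔ b)
fin a ⊔∞ ∞     = ∞
∞     ⊔∞ y     = ∞

minList : List ℕ∞ → ℕ∞
minList = foldr _⊓∞_ ∞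

maxList : List ℕ∞ → ℕ∞
maxList = foldr _⊔∞_ (fin 0)

sumℤ : List ℤ → ℤ
sumℤ = foldr ℤ._+_ 0ℤ

allVecs : ∀ {n} k → List (Vec (Fin n) k)
allVecs zero    = []ᵥ ∷ []
allVecs {n} (suc k) = concatMap (λ v → map (λ x → x ∷ᵥ v) (allFin n)) (allVecs k)

listsOfLength : ∀ {n} → ℕ → List (List (Fin n))
listsOfLength zero    = [] ∷ []
listsOfLength {n} (suc k) = concatMap (λ l → map (λ x → x ∷ l) (allFin n)) (listsOfLength k)

-- all lists over Fin n of length 0 .. n  (candidate simple paths / cycles)
candidates : ∀ n → List (List (Fin n))
candidates n = concat (map listsOfLength (upTo (suc n)))

-- Strategies.  A positional strategy is represented by a choice vector
-- over all nodes; only the entries at the player's own nodes matter and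
-- those must be out-neighbours.

module _ {n : ℕ} (G : GameGraph n) where

  IsAliceStrategy : Vec (Fin n) n → Bool
  IsAliceStrategy σ = all (λ u → not (alice G u) ∨ edge G u (lookup σ u)) (allFin n)

  IsBobStrategy : Vec (Fin n) n → Bool
  IsBobStrategy τ = all (λ u → alice G u ∨ edge G u (lookup τ u)) (allFin n)

  aliceStrategies : List (Vec (Fin n) n)
  aliceStrategies = filterᵇ IsAliceStrategy (allVecs n)

  bobStrategies : List (Vec (Fin n) n)
  bobStrategies = filterᵇ IsBobStrategy (allVecs n)

  -- The one-player-each subgraph G(σ,τ): every node u has the unique
  -- out-edge (u , succ u).

  module Play (σ τ : Vec (Fin n) n) where

    succ : Fin n → Fin n
    succ u = if alice G u then lookup σ u else lookup τ u

    linked : List (Fin n) → Bool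
    linked (u ∷ v ∷ p) = ⌊ v ≟ succ u ⌋ ∧ linked (v ∷ p)
    linked _           = true

    distinct : List (Fin n) → Bool
    distinct []      = true
    distinct (u ∷ p) = not (any (λ x → ⌊ u ≟ x ⌋) p) ∧ distinct p

    pathW : List (Fin n) → ℤ
    pathW (u ∷ v ∷ p) = w G u v ℤ.+ pathW (v ∷ p)
    pathW _           = 0ℤ

    lastOr : Fin n → List (Fin n) → Fin n
    lastOr d []      = d
    lastOr d (x ∷ p) = lastOr x p

    isSimplePathFrom : Fin n → List (Fin n) → Bool
    isSimplePathFrom s []      = false
    isSimplePathFrom s (u ∷ p) = ⌊ u ≟ s ⌋ ∧ linked (u ∷ p) ∧ distinct (u ∷ p)

    simplePathsFrom : Fin n → List (List (Fin n))
    simplePathsFrom s = filterᵇ (isSimplePathFrom s) (candidates n)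

    reachable : Fin n → Fin n → Bool
    reachable s v = any (λ p → ⌊ lastOr s p ≟ v ⌋) (simplePathsFrom s)

    isCycle : List (Fin n) → Bool
    isCycle []      = false
    isCycle (u ∷ p) = linked (u ∷ p) ∧ distinct (u ∷ p) ∧ ⌊ u ≟ succ (lastOr u p) ⌋

    cycleW : List (Fin n) → ℤ
    cycleW []      = 0ℤ
    cycleW (u ∷ p) = pathW (u ∷ p) ℤ.+ w G (lastOr u p) u

    -- the (unique, up to rotation) cycle reachable from s has negative weight
    negCycleFrom : Fin n → Bool
    negCycleFrom s = any (λ c → isCycleFrom c ∧ ⌊ cycleW c <? 0ℤ ⌋) (candidates n)
      where
        isCycleFrom : List (Fin n) → Bool
        isCycleFrom []      = false
        isCycleFrom (u ∷ p) = isCycle (u ∷ p) ∧ reachable s u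

    -- min over simple paths P from s of w(P)   (the path (s) has weight 0,
    -- so folding from 0 does not change the minimum)
    minPathW : Fin n → ℤ
    minPathW s = foldr ℤ._⊓_ 0ℤ (map pathW (simplePathsFrom s))

    energy : Fin n → ℕ∞
    energy s = if negCycleFrom s then ∞ else fin ∣ 0ℤ ℤ.⊔ (- minPathW s) ∣

  minEnergy : Fin n → ℕ∞
  minEnergy s = minList (map (λ σ → maxList (map (λ τ → Play.energy σ τ s) bobStrategies)) aliceStrategies)

  InR : ℤ → Set
  InR x = Σ (Fin n) λ u → Σ (Fin n) λ v → (edge G u v ≡ true) × (w G u v ≡ x)

  InC : ℕ∞ → Set
  InC ∞       = ⊤
  InC (fin m) = Σ (List ℤ) λ xs → (length xs ℕ.≤ n) × All InR xs × (+ m ≡ - sumℤ xs)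

InU : ℕ → ℕ∞ → Set
InU M ∞       = ⊤
InU M (fin m) = m ℕ.≤ M

-- Minima and maxima are selective: a fold of _⊓_ or _⊔_ returns one of its arguments,
-- so every property shared by the arguments passes to the result.  The minimal energy
-- is such a min-max of play energies, and a finite play energy is 0 ⊔ −m where m is
-- a ⊓-fold of 0 and the weights w(P) of simple paths P, so it is 0 or some −w(P).
-- Since both strategies only choose edges of G, w(P) is a sum of edge weights of G,
-- and P has at most n nodes, hence fewer than n edges.
module Submission where

open import Defs
open import Algebra.Core using (Op₂)
open import Algebra.Definitions using (Selective)
open import Data.Bool using (true; false; T)
open import Data.Bool.Properties using (T?; T-∧; T-≡)
open import Data.Fin using (Fin; _≟_)
open import Data.Integer as ℤ using (ℤ; +_; 0ℤ; -_; ∣_∣)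
open import Data.Integer.Properties using (⊓-sel; ⊔-sel; i≤i⊔j; 0≤i⇒+∣i∣≡i; neg-involutive)
open import Data.List using (List; []; _∷_; length)
open import Data.List.Membership.Propositional.Properties using (∈-allFin)
open import Data.List.Properties using (foldr-preservesᵇ)
open import Data.List.Relation.Unary.All as All using (All; []; _∷_)
open import Data.List.Relation.Unary.All.Properties
  using (map⁺; concat⁺; applyUpTo⁺₁; all-filter; filter⁺; all⁺)
open import Data.Nat using (ℕ; _≤_; zero; suc; z≤n; s≤s)
open import Data.Nat.Properties using (≤-trans; ≤-reflexive; ≤-pred)
import Data.Nat.Properties as ℕ
open import Data.Product using (Σ; _×_; _,_; proj₁; proj₂; uncurry)
open import Data.Sum using (inj₁; inj₂)
open import Data.Unit using (tt)
open import Data.Vec using (Vec)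
open import Function using (_∘_; id)
open import Function.Bundles using (Equivalence)
open import Relation.Nullary.Decidable using (toWitness; ⌊_⌋)
open import Relation.Binary.PropositionalEquality
  using (_≡_; refl; sym; cong; subst; module ≡-Reasoning)

open Equivalence using (to)

selective⇒preservesᵇ : ∀ {A : Set} (_∙_ : Op₂ A) → Selective _≡_ _∙_ →
                       ∀ (P : A → Set) {x y} → P x → P y → P (x ∙ y)
selective⇒preservesᵇ _ sel P {x} {y} px py with sel x y
... | inj₁ x∙y≡x = subst P (sym x∙y≡x) px
... | inj₂ x∙y≡y = subst P (sym x∙y≡y) py

⊓∞-sel : Selective _≡_ _⊓∞_
⊓∞-sel (fin a) (fin b) with ℕ.⊓-sel a b
... | inj₁ a⊓b≡a = inj₁ (cong fin a⊓b≡a)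
... | inj₂ a⊓b≡b = inj₂ (cong fin a⊓b≡b)
⊓∞-sel (fin a) ∞ = inj₁ refl
⊓∞-sel ∞       y = inj₂ refl

⊔∞-sel : Selective _≡_ _⊔∞_
⊔∞-sel (fin a) (fin b) with ℕ.⊔-sel a b
... | inj₁ a⊔b≡a = inj₁ (cong fin a⊔b≡a)
... | inj₂ a⊔b≡b = inj₂ (cong fin a⊔b≡b)
⊔∞-sel (fin a) ∞ = inj₂ refl
⊔∞-sel ∞       y = inj₁ refl

minList-preserves : ∀ {P : ℕ∞ → Set} {xs} → P ∞ → All P xs → P (minList xs)
minList-preserves {P} = foldr-preservesᵇ (selective⇒preservesᵇ _⊓∞_ ⊓∞-sel P)

maxList-preserves : ∀ {P : ℕ∞ → Set} {xs} → P (fin 0) → All P xs → P (maxList xs)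
maxList-preserves {P} = foldr-preservesᵇ (selective⇒preservesᵇ _⊔∞_ ⊔∞-sel P)

InU-bound : ∀ {M} x → (∀ m → x ≡ fin m → m ≤ M) → InU M x
InU-bound (fin m) bound = bound m refl
InU-bound ∞       _     = tt

length-listsOfLength : ∀ {n} k → All (λ (l : List (Fin n)) → length l ≡ k) (listsOfLength k)
length-listsOfLength zero    = refl ∷ []
length-listsOfLength (suc k) =
  concat⁺ (map⁺ (All.map (λ len → map⁺ (All.universal (λ _ → cong suc len) _))
                          (length-listsOfLength k)))

length-candidates : ∀ n → All (λ l → length l ≤ n) (candidates n)
length-candidates n = concat⁺ (map⁺ (applyUpTo⁺₁ id (suc n) (λ k<1+n →
  All.map (λ len → ≤-trans (≤-reflexive len) (≤-pred k<1+n)) (length-listsOfLength _))))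

module _ {n : ℕ} (G : GameGraph n) where

  EdgeWeightSum : ℤ → Set
  EdgeWeightSum z = Σ (List ℤ) λ xs → (length xs ≤ n) × All (InR G) xs × (z ≡ sumℤ xs)

  EdgeWeightSum-0 : EdgeWeightSum 0ℤ
  EdgeWeightSum-0 = [] , z≤n , [] , refl

  InC-0 : InC G (fin 0)
  InC-0 = [] , z≤n , [] , refl

  InC-fin : ∀ {y} → 0ℤ ℤ.≤ y → EdgeWeightSum (- y) → InC G (fin ∣ y ∣)
  InC-fin {y} 0≤y (xs , len , inR , -y≡Σxs) = xs , len , inR , (begin
    + ∣ y ∣   ≡⟨ 0≤i⇒+∣i∣≡i 0≤y ⟩
    y         ≡⟨ neg-involutive y ⟨
    - (- y)   ≡⟨ cong -_ -y≡Σxs ⟩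
    - sumℤ xs ∎)
    where open ≡-Reasoning

  module Paths (σ τ : Vec (Fin n) n) where
    open Play G σ τ

    edgeWeights : List (Fin n) → List ℤ
    edgeWeights (u ∷ v ∷ p) = w G u v ∷ edgeWeights (v ∷ p)
    edgeWeights _           = []

    length-edgeWeights : ∀ p → length (edgeWeights p) ≤ length p
    length-edgeWeights []          = z≤n
    length-edgeWeights (u ∷ [])    = z≤n
    length-edgeWeights (u ∷ v ∷ p) = s≤s (length-edgeWeights (v ∷ p))

    pathW≡sum-edgeWeights : ∀ p → pathW p ≡ sumℤ (edgeWeights p)
    pathW≡sum-edgeWeights []          = refl
    pathW≡sum-edgeWeights (u ∷ [])    = refl
    pathW≡sum-edgeWeights (u ∷ v ∷ p) = cong (ℤ._+_ (w G u v)) (pathW≡sum-edgeWeights (v ∷ p))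

  module _ {σ τ : Vec (Fin n) n}
           (σ-valid : T (IsAliceStrategy G σ)) (τ-valid : T (IsBobStrategy G τ)) where
    open Play G σ τ
    open Paths σ τ

    succ-edge : ∀ u → T (edge G u (succ u))
    succ-edge u with alice G u
                   | All.lookup (all⁺ _ _ σ-valid) (∈-allFin u)
                   | All.lookup (all⁺ _ _ τ-valid) (∈-allFin u)
    ... | true  | σ-edge | _      = σ-edge
    ... | false | _      | τ-edge = τ-edge

    edgeWeights-InR : ∀ p → T (linked p) → All (InR G) (edgeWeights p)
    edgeWeights-InR []          _  = []
    edgeWeights-InR (u ∷ [])    _  = []
    edgeWeights-InR (u ∷ v ∷ p) ok =
      (u , v , to T-≡ (subst (T ∘ edge G u) (sym v≡succ-u) (succ-edge u)) , refl)
      ∷ edgeWeights-InR (v ∷ p) (proj₂ (to (T-∧ {⌊ v ≟ succ u ⌋}) ok))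
      where
        v≡succ-u : v ≡ succ u
        v≡succ-u = toWitness (proj₁ (to (T-∧ {⌊ v ≟ succ u ⌋}) ok))

    simplePath-EdgeWeightSum : ∀ {s p} → T (isSimplePathFrom s p) → length p ≤ n →
                               EdgeWeightSum (pathW p)
    simplePath-EdgeWeightSum {s} {u ∷ p} ok len =
      edgeWeights (u ∷ p) ,
      ≤-trans (length-edgeWeights (u ∷ p)) len ,
      edgeWeights-InR (u ∷ p) (proj₁ (to T-∧ (proj₂ (to (T-∧ {⌊ u ≟ s ⌋}) ok)))) ,
      pathW≡sum-edgeWeights (u ∷ p)

    minPathW-EdgeWeightSum : ∀ s → EdgeWeightSum (minPathW s)
    minPathW-EdgeWeightSum s =
      foldr-preservesᵇ {P = EdgeWeightSum}
        (selective⇒preservesᵇ ℤ._⊓_ ⊓-sel EdgeWeightSum) EdgeWeightSum-0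
        (map⁺ (All.map (λ {p} → uncurry (simplePath-EdgeWeightSum {s} {p}))
          (All.zip (all-filter (T? ∘ isSimplePathFrom s) (candidates n) ,
                    filter⁺ (T? ∘ isSimplePathFrom s) (length-candidates n)))))

    energy-InC : ∀ s → InC G (energy s)
    energy-InC s with negCycleFrom s
    ... | true  = tt
    ... | false = InC-fin (i≤i⊔j 0ℤ (- minPathW s))
      (selective⇒preservesᵇ ℤ._⊔_ ⊔-sel (EdgeWeightSum ∘ -_) EdgeWeightSum-0
        (subst EdgeWeightSum (sym (neg-involutive (minPathW s))) (minPathW-EdgeWeightSum s)))

  minEnergy-InC : ∀ v → InC G (minEnergy G v)
  minEnergy-InC v =
    minList-preserves {InC G} tt (map⁺ (All.map (λ {σ} σ-valid →
      maxList-preserves {InC G} InC-0 (map⁺ (All.map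
        (λ {τ} τ-valid → energy-InC {σ} {τ} σ-valid τ-valid v)
        (all-filter (T? ∘ IsBobStrategy G) (allVecs n)))))
      (all-filter (T? ∘ IsAliceStrategy G) (allVecs n))))

lemma8 : ∀ {n : ℕ} (G : GameGraph n) (M : ℕ)
         → (∀ (v : Fin n) (m : ℕ) → minEnergy G v ≡ fin m → m ≤ M)
         → ∀ (v : Fin n) → InC G (minEnergy G v) × InU M (minEnergy G v)
lemma8 G M bound v = minEnergy-InC G v , InU-bound (minEnergy G v) (bound v)
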